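{- Let $n>3$ be an integer such that $p=4n-1$ is prime, let $M=\lfloor n^2/p\rfloor$ and for integers $m\ge 0$ let $Q_m=\frac12+\frac12\sqrt{4mp+3p-4}$. Then \[\sum_{k=1}^{n}\left\lfloor\frac{k^2-k+2-3n}{p}\right\rfloor=(M-1)n-\sum_{m=0}^{M-1}\lfloor Q_m\rfloor.\] -}

module Defs where

open import Data.Nat as ℕ using (ℕ; zero; suc; _+_; _*_; _∸_; _≤?_)
import Data.Nat.DivMod as ℕD
open import Data.Integer as ℤ using (ℤ; +_; _/ℕ_)
open import Data.List using (List; map; foldr; upTo)
open import Relation.Nullary using (yes; no)

-- ⌊ a / d ⌋ for an integer a and a natural d > 0 (floor division; _/ℕ_ rounds
-- towards -∞).  The value for d = 0 is junk and never used.
floorDiv : ℤ → ℕ → ℤ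
floorDiv a zero    = + 0
floorDiv a (suc k) = a /ℕ suc k

floorDivℕ : ℕ → ℕ → ℕ
floorDivℕ a zero    = 0
floorDivℕ a (suc k) = a ℕD./ suc k

sum1to : ℕ → (ℕ → ℤ) → ℤ
sum1to zero    f = + 0
sum1to (suc n) f = sum1to n f ℤ.+ f (suc n)

sum0below : ℕ → (ℕ → ℤ) → ℤ
sum0below zero    f = + 0
sum0below (suc M) f = sum0below M f ℤ.+ f M

-- ⌊ 1/2 + 1/2 √N ⌋ for a natural N, without real numbers:
-- for a natural q, q ≤ 1/2 + 1/2 √N  ⟺  2q - 1 ≤ √N  ⟺  (2q ∸ 1)² ≤ N
-- (q = 0 always qualifies).  The floor is the largest such q; it is at most N + 1,
-- so we search downward from N + 1.
largestBelow : ℕ → (ℕ → ℕ) → ℕ → ℕ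
largestBelow zero    g N = 0
largestBelow (suc b) g N with g (suc b) ≤? N
... | yes _ = suc b
... | no  _ = largestBelow b g N

floorHalfOnePlusSqrt : ℕ → ℕ
floorHalfOnePlusSqrt N = largestBelow (suc N) (λ q → (2 * q ∸ 1) * (2 * q ∸ 1)) N

-- Q_m = 1/2 + 1/2 √(4mp + 3p - 4); ⌊Q_m⌋ (note 3p ≥ 4 for the primes in question;
-- truncated subtraction is used, which agrees with real subtraction whenever 3p ≥ 4).
floorQ : ℕ → ℕ → ℕ
floorQ p m = floorHalfOnePlusSqrt (4 * m * p + 3 * p ∸ 4)

{-# OPTIONS --safe #-}
module Submission where

-- Write k = j + 1 and p = 4n − 1.  Adding p to the numerator, the k-th summand becomes
-- ⌊b_j / p⌋ − 1 with b_j = j(j + 1) + n + 1, and ⌊b_j / p⌋ counts the m with (m + 1)p ≤ b_j.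
-- Multiplied by 4 this condition reads 4mp + 3p − 4 ≤ (2j + 1)², and equality never occurs,
-- since it would make −4 a square modulo the prime p ≡ 3 (mod 4).  Hence (m + 1)p ≤ b_j
-- exactly when ⌊Q_m⌋ ≤ j, and counting the pairs (m, j) by m instead of by j turns Σ_j ⌊b_j / p⌋
-- into Σ_{m<M} (n − ⌊Q_m⌋).  The largest b_j is n² + 1, not a multiple of p for the same reason,
-- so all the quotients are at most M.

open import Defs

module FiniteSums where

  open import Data.Bool.Base using (if_then_else_)
  open import Data.Nat.Base
  open import Data.Nat.Divisibility using (_∣_; _∣0; ∣m∣n⇒∣m+n)
  open import Data.Nat.Properties
  open import Algebra.Properties.CommutativeSemigroup +-commutativeSemigroup using () renaming (interchange to +-interchange)
  open import Function.Base using (_∘_)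
  open import Function.Bundles using (_⇔_)
  open import Relation.Binary.PropositionalEquality
  open import Relation.Nullary.Decidable using (Dec; yes; no; does; dec-true; dec-false; does-⇔)
  open import Relation.Nullary.Negation using (¬_)

  sum0belowℕ : ℕ → (ℕ → ℕ) → ℕ
  sum0belowℕ zero    f = 0
  sum0belowℕ (suc M) f = sum0belowℕ M f + f M

  sum0belowℕ-cong : ∀ M {f g} → (∀ {m} → m < M → f m ≡ g m) → sum0belowℕ M f ≡ sum0belowℕ M g
  sum0belowℕ-cong zero    f≗g = refl
  sum0belowℕ-cong (suc M) f≗g = cong₂ _+_ (sum0belowℕ-cong M (f≗g ∘ m<n⇒m<1+n)) (f≗g (n<1+n M))

  sum0belowℕ-suc : ∀ L f → sum0belowℕ (suc L) f ≡ f 0 + sum0belowℕ L (f ∘ suc)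
  sum0belowℕ-suc zero    f = +-comm 0 (f 0)
  sum0belowℕ-suc (suc L) f = begin
    sum0belowℕ (suc L) f + f (suc L)           ≡⟨ cong (_+ f (suc L)) (sum0belowℕ-suc L f) ⟩
    f 0 + sum0belowℕ L (f ∘ suc) + f (suc L)   ≡⟨ +-assoc (f 0) _ _ ⟩
    f 0 + sum0belowℕ (suc L) (f ∘ suc)         ∎
    where open ≡-Reasoning

  ∣-sum0belowℕ : ∀ {d} L {f} → (∀ {k} → k < L → d ∣ f k) → d ∣ sum0belowℕ L f
  ∣-sum0belowℕ zero    d∣f = _ ∣0
  ∣-sum0belowℕ (suc L) d∣f = ∣m∣n⇒∣m+n (∣-sum0belowℕ L (d∣f ∘ m<n⇒m<1+n)) (d∣f (n<1+n L))

  indicator : ∀ {A : Set} → Dec A → ℕ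
  indicator a? = if does a? then 1 else 0

  indicator-yes : ∀ {A : Set} (a? : Dec A) → A → indicator a? ≡ 1
  indicator-yes a? a = cong (if_then 1 else 0) (dec-true a? a)

  indicator-no : ∀ {A : Set} (a? : Dec A) → ¬ A → indicator a? ≡ 0
  indicator-no a? ¬a = cong (if_then 1 else 0) (dec-false a? ¬a)

  indicator-⇔ : ∀ {A B : Set} → A ⇔ B → (a? : Dec A) (b? : Dec B) → indicator a? ≡ indicator b?
  indicator-⇔ A⇔B a? b? = cong (if_then 1 else 0) (does-⇔ A⇔B a? b?)

  sum0belowℕ-+ : ∀ M f g → sum0belowℕ M (λ m → f m + g m) ≡ sum0belowℕ M f + sum0belowℕ M g
  sum0belowℕ-+ zero    f g = refl
  sum0belowℕ-+ (suc M) f g = begin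
    sum0belowℕ M (λ m → f m + g m) + (f M + g M)          ≡⟨ cong (_+ (f M + g M)) (sum0belowℕ-+ M f g) ⟩
    sum0belowℕ M f + sum0belowℕ M g + (f M + g M)         ≡⟨ +-interchange (sum0belowℕ M f) (sum0belowℕ M g) (f M) (g M) ⟩
    sum0belowℕ M f + f M + (sum0belowℕ M g + g M)         ∎
    where open ≡-Reasoning

  sum0belowℕ-swap : ∀ n M (h : ℕ → ℕ → ℕ) →
    sum0belowℕ n (λ j → sum0belowℕ M (λ m → h m j)) ≡ sum0belowℕ M (λ m → sum0belowℕ n (h m))
  sum0belowℕ-swap n zero    h = sum0belowℕ-zero n
    where
    sum0belowℕ-zero : ∀ n → sum0belowℕ n (λ _ → 0) ≡ 0
    sum0belowℕ-zero zero    = refl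
    sum0belowℕ-zero (suc n) = trans (+-identityʳ _) (sum0belowℕ-zero n)
  sum0belowℕ-swap n (suc M) h =
    trans (sum0belowℕ-+ n (λ j → sum0belowℕ M (λ m → h m j)) (h M)) (cong (_+ sum0belowℕ n (h M)) (sum0belowℕ-swap n M h))

  count-< : ∀ M q → sum0belowℕ M (λ m → indicator (m <? q)) ≡ M ⊓ q
  count-< zero    q = refl
  count-< (suc M) q with M <? q
  ... | yes M<q = begin
    sum0belowℕ M (λ m → indicator (m <? q)) + indicator (M <? q) ≡⟨ cong₂ _+_ (count-< M q) (indicator-yes (M <? q) M<q) ⟩
    M ⊓ q + 1                                                    ≡⟨ cong (_+ 1) (m≤n⇒m⊓n≡m (<⇒≤ M<q)) ⟩
    M + 1                                                        ≡⟨ +-comm M 1 ⟩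
    suc M                                                        ≡⟨ m≤n⇒m⊓n≡m M<q ⟨
    suc M ⊓ q                                                    ∎
    where open ≡-Reasoning
  ... | no  M≮q = begin
    sum0belowℕ M (λ m → indicator (m <? q)) + indicator (M <? q) ≡⟨ cong₂ _+_ (count-< M q) (indicator-no (M <? q) M≮q) ⟩
    M ⊓ q + 0                                                    ≡⟨ +-identityʳ (M ⊓ q) ⟩
    M ⊓ q                                                        ≡⟨ m≥n⇒m⊓n≡n q≤M ⟩
    q                                                            ≡⟨ m≥n⇒m⊓n≡n (m≤n⇒m≤1+n q≤M) ⟨
    suc M ⊓ q                                                    ∎
    where open ≡-Reasoning
          q≤M = ≮⇒≥ M≮q

  count-≥ : ∀ n K → sum0belowℕ n (λ j → indicator (K ≤? j)) ≡ n ∸ K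
  count-≥ zero    K = sym (0∸n≡0 K)
  count-≥ (suc n) K with K ≤? n
  ... | yes K≤n = begin
    sum0belowℕ n (λ j → indicator (K ≤? j)) + indicator (K ≤? n) ≡⟨ cong₂ _+_ (count-≥ n K) (indicator-yes (K ≤? n) K≤n) ⟩
    n ∸ K + 1                                                    ≡⟨ +-comm (n ∸ K) 1 ⟩
    suc (n ∸ K)                                                  ≡⟨ +-∸-assoc 1 K≤n ⟨
    suc n ∸ K                                                    ∎
    where open ≡-Reasoning
  ... | no  K≰n = begin
    sum0belowℕ n (λ j → indicator (K ≤? j)) + indicator (K ≤? n) ≡⟨ cong₂ _+_ (count-≥ n K) (indicator-no (K ≤? n) K≰n) ⟩
    n ∸ K + 0                                                    ≡⟨ +-identityʳ (n ∸ K) ⟩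
    n ∸ K                                                        ≡⟨ m≤n⇒m∸n≡0 (<⇒≤ n<K) ⟩
    0                                                            ≡⟨ m≤n⇒m∸n≡0 n<K ⟨
    suc n ∸ K                                                    ∎
    where open ≡-Reasoning
          n<K = ≰⇒> K≰n

  sum0belowℕ-∸ : ∀ M n K → (∀ {m} → m < M → K m ≤ n) →
    sum0belowℕ M (λ m → n ∸ K m) + sum0belowℕ M K ≡ M * n
  sum0belowℕ-∸ M n K K≤n = begin
    sum0belowℕ M (λ m → n ∸ K m) + sum0belowℕ M K   ≡⟨ sum0belowℕ-+ M (λ m → n ∸ K m) K ⟨
    sum0belowℕ M (λ m → n ∸ K m + K m)              ≡⟨ sum0belowℕ-cong M (m∸n+n≡m ∘ K≤n) ⟩
    sum0belowℕ M (λ _ → n)                           ≡⟨ sum0belowℕ-const M n ⟩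
    M * n                                            ∎
    where
    open ≡-Reasoning
    sum0belowℕ-const : ∀ M n → sum0belowℕ M (λ _ → n) ≡ M * n
    sum0belowℕ-const zero    n = refl
    sum0belowℕ-const (suc M) n = trans (cong (_+ n) (sum0belowℕ-const M n)) (+-comm (M * n) n)

module QuadraticNonresidue where

  open import Data.Empty using (⊥-elim)
  open import Data.Nat.Base
  open import Data.Nat.Combinatorics using (_C_; nCk≡n!/k![n-k]!; k![n∸k]!∣n!; nCk+nC[k+1]≡[n+1]C[k+1]; k>n⇒nCk≡0; nCn≡1)
  open import Data.Nat.Divisibility
  open import Data.Nat.DivMod using (_/_; m/n*n≡m)
  open import Data.Nat.Primality using (Prime; euclidsLemma; prime⇒nonTrivial)
  open import Data.Nat.Properties
  open import Data.Nat.Tactic.RingSolver using (solve-∀)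
  open import Data.Product.Base using (∃-syntax; _,_)
  open import Data.Sum.Base using ([_,_]′)
  open import Function.Base using (_∘_; id)
  open import Relation.Binary.PropositionalEquality
  open import Relation.Nullary.Negation using (¬_)
  open FiniteSums using (sum0belowℕ; sum0belowℕ-suc; ∣-sum0belowℕ)

  p∤m! : ∀ {p m} → Prime p → m < p → ¬ p ∣ m !
  p∤m! {p} {zero}  pr _   p∣1 = <⇒≱ (nonTrivial⇒n>1 p {{prime⇒nonTrivial pr}}) (∣⇒≤ p∣1)
  p∤m! {p} {suc m} pr m<p p∣m! =
    [ (λ p∣1+m → <⇒≱ m<p (∣⇒≤ p∣1+m)) , p∤m! pr (<-trans (n<1+n m) m<p) ]′ (euclidsLemma (suc m) (m !) pr p∣m!)

  nCk*[k!*[n∸k]!]≡n! : ∀ {n k} → k ≤ n → (n C k) * (k ! * (n ∸ k) !) ≡ n !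
  nCk*[k!*[n∸k]!]≡n! {n} {k} k≤n = begin
    (n C k) * (k ! * (n ∸ k) !)                  ≡⟨ cong (_* (k ! * (n ∸ k) !)) (nCk≡n!/k![n-k]! k≤n) ⟩
    (n ! / (k ! * (n ∸ k) !)) * (k ! * (n ∸ k) !) ≡⟨ m/n*n≡m (k![n∸k]!∣n! k≤n) ⟩
    n !                                          ∎
    where open ≡-Reasoning
          instance _ = k !* (n ∸ k) !≢0

  p∣pCk : ∀ {p k} → Prime p → 0 < k → k < p → p ∣ p C k
  p∣pCk {p@(suc p-1)} {k} pr 0<k k<p =
    [ id , ⊥-elim ∘ p∤k!*[p∸k]! ]′ (euclidsLemma (p C k) (k ! * (p ∸ k) !) pr p∣pCk*[k!*[p∸k]!])
    where
    p∣pCk*[k!*[p∸k]!] : p ∣ (p C k) * (k ! * (p ∸ k) !)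
    p∣pCk*[k!*[p∸k]!] = subst (p ∣_) (sym (nCk*[k!*[n∸k]!]≡n! (<⇒≤ k<p))) (m∣m*n (p-1 !))
    p∤k!*[p∸k]! : ¬ p ∣ k ! * (p ∸ k) !
    p∤k!*[p∸k]! p∣k!*[p∸k]! = [ p∤m! pr k<p , p∤m! pr (∸-monoʳ-< 0<k (<⇒≤ k<p)) ]′
                                (euclidsLemma (k !) ((p ∸ k) !) pr p∣k!*[p∸k]!)

  binomialTerm : ℕ → ℕ → ℕ → ℕ
  binomialTerm n a k = (n C k) * a ^ k

  sum-binomialTerm-pascal : ∀ n a L →
    sum0belowℕ (suc L) (binomialTerm (suc n) a)
      ≡ sum0belowℕ (suc L) (binomialTerm n a) + a * sum0belowℕ L (binomialTerm n a)
  sum-binomialTerm-pascal n a zero    = cong suc (sym (*-zeroʳ a))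
  sum-binomialTerm-pascal n a (suc L) = begin
    sum0belowℕ (suc L) T′ + (suc n C suc L) * a ^ suc L
      ≡⟨ cong₂ (λ s c → s + c * a ^ suc L) (sum-binomialTerm-pascal n a L) (sym (nCk+nC[k+1]≡[n+1]C[k+1] n L)) ⟩
    sum0belowℕ (suc L) T + a * sum0belowℕ L T + ((n C L) + (n C suc L)) * (a * a ^ L)
      ≡⟨ regroup (sum0belowℕ (suc L) T) a (sum0belowℕ L T) (n C L) (n C suc L) (a ^ L) ⟩
    sum0belowℕ (suc L) T + (n C suc L) * a ^ suc L + a * (sum0belowℕ L T + (n C L) * a ^ L) ∎
    where
    open ≡-Reasoning
    T = binomialTerm n a
    T′ = binomialTerm (suc n) a
    regroup : ∀ x a y c d z → x + a * y + (c + d) * (a * z) ≡ x + d * (a * z) + a * (y + c * z)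
    regroup = solve-∀

  [1+a]^n≡sum-binomialTerm : ∀ n a → (1 + a) ^ n ≡ sum0belowℕ (suc n) (binomialTerm n a)
  [1+a]^n≡sum-binomialTerm zero    a = refl
  [1+a]^n≡sum-binomialTerm (suc n) a = begin
    (1 + a) * (1 + a) ^ n                           ≡⟨ cong ((1 + a) *_) ([1+a]^n≡sum-binomialTerm n a) ⟩
    S + a * S                                       ≡⟨ cong (_+ a * S) S≡S+top ⟩
    sum0belowℕ (suc (suc n)) T + a * S              ≡⟨ sum-binomialTerm-pascal n a (suc n) ⟨
    sum0belowℕ (suc (suc n)) (binomialTerm (suc n) a) ∎
    where
    open ≡-Reasoning
    T = binomialTerm n a
    S = sum0belowℕ (suc n) T
    S≡S+top : S ≡ S + (n C suc n) * a ^ suc n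
    S≡S+top = sym (trans (cong (λ c → S + c * a ^ suc n) (k>n⇒nCk≡0 (n<1+n n))) (+-identityʳ S))

  p∣binomialTerm : ∀ {p k} → Prime p → 0 < k → k < p → ∀ a → p ∣ binomialTerm p a k
  p∣binomialTerm {k = k} pr 0<k k<p a = ∣m⇒∣m*n (a ^ k) (p∣pCk pr 0<k k<p)

  fermat : ∀ {p} → Prime p → ∀ a → ∃[ s ] a ^ p ≡ a + p * s
  fermat {p@(suc _)} pr zero    = 0 , sym (*-zeroʳ p)
  fermat {p@(suc p-1)} pr (suc a)
    with fermat pr a | ∣-sum0belowℕ p-1 (λ k<p-1 → p∣binomialTerm pr z<s (s<s k<p-1) a)
  ... | s , a^p≡a+ps | divides t middle≡tp = t + s , (begin
    (1 + a) ^ p                                                    ≡⟨ [1+a]^n≡sum-binomialTerm p a ⟩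
    sum0belowℕ p (binomialTerm p a) + (p C p) * a ^ p              ≡⟨ cong₂ (λ u c → u + c * a ^ p) (sum0belowℕ-suc p-1 _) (nCn≡1 p) ⟩
    1 + sum0belowℕ p-1 (binomialTerm p a ∘ suc) + 1 * a ^ p         ≡⟨ cong₂ (λ u v → 1 + u + 1 * v) middle≡tp a^p≡a+ps ⟩
    1 + t * p + 1 * (a + p * s)                                   ≡⟨ regroup t p a s ⟩
    suc a + p * (t + s)                                           ∎)
    where
    open ≡-Reasoning
    regroup : ∀ t p a s → 1 + t * p + 1 * (a + p * s) ≡ suc a + p * (t + s)
    regroup = solve-∀

  m+n∣m^[1+2k]+n^[1+2k] : ∀ m n k → m + n ∣ m ^ (1 + 2 * k) + n ^ (1 + 2 * k)
  m+n∣m^[1+2k]+n^[1+2k] m n zero    = divides 1 (base m n)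
    where
    base : ∀ m n → m * 1 + n * 1 ≡ 1 * (m + n)
    base = solve-∀
  m+n∣m^[1+2k]+n^[1+2k] m n (suc k) =
    ∣m+n∣m⇒∣n (subst (m + n ∣_) expand (n∣m*n (m * P + n * Q))) (∣n⇒∣m*n (m * n) (m+n∣m^[1+2k]+n^[1+2k] m n k))
    where
    P = m ^ (1 + 2 * k)
    Q = n ^ (1 + 2 * k)
    ^[1+2[1+k]] : ∀ x → x ^ (1 + 2 * suc k) ≡ x * (x * x ^ (1 + 2 * k))
    ^[1+2[1+k]] x = cong (λ e → x ^ suc e) (*-suc 2 k)
    factor : ∀ m n P Q → (m * P + n * Q) * (m + n) ≡ m * n * (P + Q) + (m * (m * P) + n * (n * Q))
    factor = solve-∀
    expand : (m * P + n * Q) * (m + n) ≡ m * n * (P + Q) + (m ^ (1 + 2 * suc k) + n ^ (1 + 2 * suc k))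
    expand = trans (factor m n P Q) (cong (m * n * (P + Q) +_) (sym (cong₂ _+_ (^[1+2[1+k]] m) (^[1+2[1+k]] n))))

  m*[m*m]^k≡m^[1+2k] : ∀ m k → m * (m * m) ^ k ≡ m ^ (1 + 2 * k)
  m*[m*m]^k≡m^[1+2k] m zero    = refl
  m*[m*m]^k≡m^[1+2k] m (suc k) = begin
    m * ((m * m) * (m * m) ^ k)   ≡⟨ rearrange m ((m * m) ^ k) ⟩
    m * (m * (m * (m * m) ^ k))   ≡⟨ cong (λ y → m * (m * y)) (m*[m*m]^k≡m^[1+2k] m k) ⟩
    m * (m * m ^ (1 + 2 * k))     ≡⟨ cong (λ e → m ^ suc e) (*-suc 2 k) ⟨
    m ^ (1 + 2 * suc k)           ∎
    where
    open ≡-Reasoning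
    rearrange : ∀ m y → m * ((m * m) * y) ≡ m * (m * (m * y))
    rearrange = solve-∀

  -- With h = (p − 1)/2 odd, p ∣ x² + 4 ∣ (x²)^h + 4^h = x^(p−1) + 2^(p−1), while Fermat gives
  -- x · x^(p−1) ≡ x and 2 · 2^(p−1) ≡ 2 (mod p); together p ∣ 4x, and then p ∣ 4 either way.
  prime[3+4e]∤x²+4 : ∀ e → Prime (3 + 4 * e) → ∀ x → ¬ (3 + 4 * e) ∣ x * x + 4
  prime[3+4e]∤x²+4 e pr x p∣x²+4 = p∤4 p∣4
    where
    p = 3 + 4 * e
    k = 1 + 2 * e
    A = (x * x) ^ k
    B = 4 ^ k
    m*[m*m]^k≡m^p : ∀ m → m * (m * m) ^ k ≡ m ^ p
    m*[m*m]^k≡m^p m = trans (m*[m*m]^k≡m^[1+2k] m k) (cong (m ^_) (1+2[1+2e]≡3+4e e))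
      where
      1+2[1+2e]≡3+4e : ∀ e → 1 + 2 * (1 + 2 * e) ≡ 3 + 4 * e
      1+2[1+2e]≡3+4e = solve-∀
    p∣A+B : p ∣ A + B
    p∣A+B = ∣-trans p∣x²+4 (m+n∣m^[1+2k]+n^[1+2k] (x * x) 4 e)
    p∤4 : ¬ p ∣ 4
    p∤4 p∣2*2 = [ p∤2 , p∤2 ]′ (euclidsLemma 2 2 pr p∣2*2)
      where
      p∤2 : ¬ p ∣ 2
      p∤2 p∣2 = <⇒≱ (s≤s (s≤s (s≤s z≤n))) (∣⇒≤ p∣2)
    p∣4x : p ∣ 4 * x
    p∣4x = from-fermat (fermat pr x) (fermat pr 2)
      where
      from-fermat : ∃[ s ] x ^ p ≡ x + p * s → ∃[ t ] 2 ^ p ≡ 2 + p * t → p ∣ 4 * x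
      from-fermat (s , x^p≡x+ps) (t , 2^p≡2+pt) =
        ∣m+n∣m⇒∣n (subst (p ∣_) 2x[A+B]≡ps′+4x (∣n⇒∣m*n (2 * x) p∣A+B)) (m∣m*n (2 * s + x * t))
        where
        open ≡-Reasoning
        expand : ∀ x s t p → 2 * (x + p * s) + x * (2 + p * t) ≡ p * (2 * s + x * t) + 4 * x
        expand = solve-∀
        distrib : ∀ x A B → 2 * x * (A + B) ≡ 2 * (x * A) + x * (2 * B)
        distrib = solve-∀
        2x[A+B]≡ps′+4x : 2 * x * (A + B) ≡ p * (2 * s + x * t) + 4 * x
        2x[A+B]≡ps′+4x = begin
          2 * x * (A + B)                   ≡⟨ distrib x A B ⟩
          2 * (x * A) + x * (2 * B)         ≡⟨ cong₂ (λ u v → 2 * u + x * v) (trans (m*[m*m]^k≡m^p x) x^p≡x+ps) (trans (m*[m*m]^k≡m^p 2) 2^p≡2+pt) ⟩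
          2 * (x + p * s) + x * (2 + p * t) ≡⟨ expand x s t p ⟩
          p * (2 * s + x * t) + 4 * x       ∎
    p∣4 : p ∣ 4
    p∣4 = [ id , (λ p∣x → ∣m+n∣m⇒∣n p∣x²+4 (∣m⇒∣m*n x p∣x)) ]′ (euclidsLemma 4 x pr p∣4x)

module LatticePointCount where

  open import Data.Nat.Base
  open import Data.Nat.Divisibility using (_∣_; divides; ∣n⇒∣m*n)
  open import Data.Nat.DivMod using (_/_; m/n*n≤m; m*n/n≡m; /-monoˡ-≤)
  open import Data.Nat.Primality using (Prime)
  open import Data.Nat.Properties
  open import Data.Nat.Tactic.RingSolver using (solve-∀)
  open import Data.Sum.Base using (inj₁; inj₂)
  open import Function.Base using (_∘_)
  open import Function.Bundles using (_⇔_; mk⇔; module Equivalence)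
  import Function.Properties.Equivalence as ⇔
  open import Relation.Binary.PropositionalEquality
  open import Relation.Nullary.Decidable using (yes; no)
  open import Relation.Nullary.Negation using (¬_; contradiction)
  open Equivalence using (to; from)
  open FiniteSums
  open QuadraticNonresidue using (prime[3+4e]∤x²+4)

  largestBelow-≤ : ∀ b g N → largestBelow b g N ≤ b
  largestBelow-≤ zero    g N = z≤n
  largestBelow-≤ (suc b) g N with g (suc b) ≤? N
  ... | yes _ = ≤-refl
  ... | no  _ = m≤n⇒m≤1+n (largestBelow-≤ b g N)

  ≤largestBelow⇔ : ∀ {g} → (∀ {q r} → q ≤ r → g q ≤ g r) →
    ∀ b N {q} → 0 < q → q ≤ b → (q ≤ largestBelow b g N ⇔ g q ≤ N)
  ≤largestBelow⇔         mono zero    N (s≤s _) ()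
  ≤largestBelow⇔ {g = g} mono (suc b) N {q} 0<q q≤1+b with g (suc b) ≤? N | m≤n⇒m<n∨m≡n q≤1+b
  ... | yes g[1+b]≤N | _            = mk⇔ (λ _ → ≤-trans (mono q≤1+b) g[1+b]≤N) (λ _ → q≤1+b)
  ... | no  _        | inj₁ q<1+b   = ≤largestBelow⇔ mono b N 0<q (s≤s⁻¹ q<1+b)
  ... | no  g[1+b]≰N | inj₂ refl    =
    mk⇔ (λ 1+b≤r → contradiction (≤-trans 1+b≤r (largestBelow-≤ b g N)) (1+n≰n {b}))
        (λ g[1+b]≤N → contradiction g[1+b]≤N g[1+b]≰N)

  m*o≤n⇒m≤n/o : ∀ {m n} o .{{_ : NonZero o}} → m * o ≤ n → m ≤ n / o
  m*o≤n⇒m≤n/o {m} o m*o≤n = subst (_≤ _ / o) (m*n/n≡m m o) (/-monoˡ-≤ o m*o≤n)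

  m<n/o⇔[1+m]*o≤n : ∀ {m n} o .{{_ : NonZero o}} → (m < n / o ⇔ suc m * o ≤ n)
  m<n/o⇔[1+m]*o≤n {m} {n} o = mk⇔ (λ 1+m≤n/o → ≤-trans (*-monoˡ-≤ o 1+m≤n/o) (m/n*n≤m n o)) (m*o≤n⇒m≤n/o o)

  [1+m]/n≡m/n : ∀ {m} n .{{_ : NonZero n}} → ¬ n ∣ suc m → suc m / n ≡ m / n
  [1+m]/n≡m/n {m} n n∤1+m = ≤-antisym (m*o≤n⇒m≤n/o n [1+m]/n*n≤m) (/-monoˡ-≤ n (n≤1+n m))
    where
    [1+m]/n*n≤m : suc m / n * n ≤ m
    [1+m]/n*n≤m = s≤s⁻¹ (≤∧≢⇒< (m/n*n≤m (suc m) n) (λ eq → n∤1+m (divides (suc m / n) (sym eq))))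

  ≤⇔≤-after-scaling : ∀ k .{{_ : NonZero k}} {a b c A B} → k * a ≡ c + A → k * b ≡ c + B → (a ≤ b ⇔ A ≤ B)
  ≤⇔≤-after-scaling k {a} {b} {c} {A} {B} ka≡c+A kb≡c+B = mk⇔
    (λ a≤b → +-cancelˡ-≤ c A B (subst₂ _≤_ ka≡c+A kb≡c+B (*-monoʳ-≤ k a≤b)))
    (λ A≤B → *-cancelˡ-≤ k (subst₂ _≤_ (sym ka≡c+A) (sym kb≡c+B) (+-monoʳ-≤ c A≤B)))

  module Setting (e : ℕ) (pr : Prime (3 + 4 * e)) where

    n p M : ℕ
    n = suc e
    p = 3 + 4 * e
    M = n * n / p

    -- The numerator k² − k + 2 − 3n of the k-th summand plus p, written in terms of j = k − 1.
    numerator : ℕ → ℕ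
    numerator j = j * suc j + n + 1

    quotient : ℕ → ℕ
    quotient j = numerator j / p

    radicand : ℕ → ℕ
    radicand m = 4 * m * p + 3 * p ∸ 4

    ⌊Q⌋ : ℕ → ℕ
    ⌊Q⌋ m = floorQ p m

    odd² : ℕ → ℕ
    odd² j = (1 + 2 * j) * (1 + 2 * j)

    radicand+4 : ∀ m → radicand m + 4 ≡ (4 * m + 3) * p
    radicand+4 m = trans (m∸n+n≡m 4≤4mp+3p) (sym (*-distribʳ-+ p (4 * m) 3))
      where
      4≤4mp+3p : 4 ≤ 4 * m * p + 3 * p
      4≤4mp+3p = ≤-trans (≤-trans (m≤m+n 4 5) (*-monoʳ-≤ 3 (m≤m+n 3 (4 * e)))) (m≤n+m (3 * p) (4 * m * p))

    -- Equality would make −4 a square modulo p.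
    odd²≢radicand : ∀ j m → odd² j ≢ radicand m
    odd²≢radicand j m eq =
      prime[3+4e]∤x²+4 e pr (1 + 2 * j) (divides (4 * m + 3) (trans (cong (_+ 4) eq) (radicand+4 m)))

    [1+m]p≤numerator⇔radicand≤odd² : ∀ m j → (suc m * p ≤ numerator j ⇔ radicand m ≤ odd² j)
    [1+m]p≤numerator⇔radicand≤odd² m j = ≤⇔≤-after-scaling 4 {c = p + 4} 4[1+m]p (expand-numerator j e)
      where
      expand-numerator : ∀ j e → 4 * (j * suc j + suc e + 1) ≡ (3 + 4 * e) + 4 + (1 + 2 * j) * (1 + 2 * j)
      expand-numerator = solve-∀
      expand-multiple : ∀ m p → 4 * (suc m * p) ≡ p + (4 * m + 3) * p
      expand-multiple = solve-∀
      4[1+m]p : 4 * (suc m * p) ≡ p + 4 + radicand m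
      4[1+m]p = begin
        4 * (suc m * p)           ≡⟨ expand-multiple m p ⟩
        p + (4 * m + 3) * p       ≡⟨ cong (p +_) (radicand+4 m) ⟨
        p + (radicand m + 4)      ≡⟨ cong (p +_) (+-comm (radicand m) 4) ⟩
        p + (4 + radicand m)      ≡⟨ +-assoc p 4 (radicand m) ⟨
        p + 4 + radicand m        ∎
        where open ≡-Reasoning

    m<quotient⇔radicand<odd² : ∀ m j → (m < quotient j ⇔ radicand m < odd² j)
    m<quotient⇔radicand<odd² m j = mk⇔
      (λ m<quotient → ≤∧≢⇒< (to step (to (m<n/o⇔[1+m]*o≤n p) m<quotient)) (odd²≢radicand j m ∘ sym))
      (λ r<o → from (m<n/o⇔[1+m]*o≤n p) (from step (<⇒≤ r<o)))
      where step = [1+m]p≤numerator⇔radicand≤odd² m j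

    ⌊Q⌋≤j⇔radicand<odd² : ∀ m j → j ≤ radicand m → (⌊Q⌋ m ≤ j ⇔ radicand m < odd² j)
    ⌊Q⌋≤j⇔radicand<odd² m j j≤N = mk⇔
      (λ ⌊Q⌋≤j → ≰⇒> (λ odd²≤N → ≤⇒≯ ⌊Q⌋≤j (from spec odd²≤N)))
      (λ N<odd² → ≮⇒≥ (λ j<⌊Q⌋ → <⇒≱ N<odd² (to spec j<⌊Q⌋)))
      where
      monotone : ∀ {q r} → q ≤ r → (2 * q ∸ 1) * (2 * q ∸ 1) ≤ (2 * r ∸ 1) * (2 * r ∸ 1)
      monotone q≤r = *-mono-≤ 2q-1≤2r-1 2q-1≤2r-1
        where 2q-1≤2r-1 = ∸-monoˡ-≤ 1 (*-monoʳ-≤ 2 q≤r)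
      spec : suc j ≤ ⌊Q⌋ m ⇔ odd² j ≤ radicand m
      spec = subst (λ x → suc j ≤ ⌊Q⌋ m ⇔ x * x ≤ radicand m) (cong (_∸ 1) (*-suc 2 j))
               (≤largestBelow⇔ monotone (suc (radicand m)) (radicand m) z<s (s≤s j≤N))

    n≤radicand : ∀ m → n ≤ radicand m
    n≤radicand m = +-cancelʳ-≤ 4 n (radicand m) (begin
      n + 4                ≤⟨ m≤m+n (n + 4) (4 + 11 * e) ⟩
      n + 4 + (4 + 11 * e) ≡⟨ expand-3p e ⟩
      3 * p                ≤⟨ *-monoˡ-≤ p (m≤n+m 3 (4 * m)) ⟩
      (4 * m + 3) * p      ≡⟨ radicand+4 m ⟨
      radicand m + 4       ∎)
      where
      open ≤-Reasoning
      expand-3p : ∀ e → suc e + 4 + (4 + 11 * e) ≡ 3 * (3 + 4 * e)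
      expand-3p = solve-∀

    m<quotient⇔⌊Q⌋≤j : ∀ {m j} → j < n → (m < quotient j ⇔ ⌊Q⌋ m ≤ j)
    m<quotient⇔⌊Q⌋≤j {m} {j} j<n =
      ⇔.trans (m<quotient⇔radicand<odd² m j) (⇔.sym (⌊Q⌋≤j⇔radicand<odd² m j (≤-trans (<⇒≤ j<n) (n≤radicand m))))

    quotient[e]≡M : quotient e ≡ M
    quotient[e]≡M = trans (cong (_/ p) (numerator[e]≡1+n*n e)) ([1+m]/n≡m/n p p∤1+n*n)
      where
      numerator[e]≡1+n*n : ∀ e → e * suc e + suc e + 1 ≡ suc (suc e * suc e)
      numerator[e]≡1+n*n = solve-∀
      4[1+n*n]≡[2n]²+4 : ∀ n → 4 * suc (n * n) ≡ 2 * n * (2 * n) + 4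
      4[1+n*n]≡[2n]²+4 = solve-∀
      p∤1+n*n : ¬ p ∣ suc (n * n)
      p∤1+n*n p∣1+n*n = prime[3+4e]∤x²+4 e pr (2 * n) (subst (p ∣_) (4[1+n*n]≡[2n]²+4 n) (∣n⇒∣m*n 4 p∣1+n*n))

    quotient≤M : ∀ {j} → j < n → quotient j ≤ M
    quotient≤M {j} (s≤s j≤e) = subst (quotient j ≤_) quotient[e]≡M (/-monoˡ-≤ p numerator-mono)
      where numerator-mono = +-monoˡ-≤ 1 (+-monoˡ-≤ n (*-mono-≤ j≤e (s≤s j≤e)))

    ⌊Q⌋<n : ∀ {m} → m < M → ⌊Q⌋ m < n
    ⌊Q⌋<n {m} m<M = s≤s (to (m<quotient⇔⌊Q⌋≤j ≤-refl) (subst (m <_) (sym quotient[e]≡M) m<M))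

    sum-quotient≡sum[n∸⌊Q⌋] : sum0belowℕ n quotient ≡ sum0belowℕ M (λ m → n ∸ ⌊Q⌋ m)
    sum-quotient≡sum[n∸⌊Q⌋] = begin
      sum0belowℕ n quotient
        ≡⟨ sum0belowℕ-cong n (λ j<n → trans (sym (m≥n⇒m⊓n≡n (quotient≤M j<n))) (sym (count-< M _))) ⟩
      sum0belowℕ n (λ j → sum0belowℕ M (λ m → indicator (m <? quotient j)))
        ≡⟨ sum0belowℕ-swap n M (λ m j → indicator (m <? quotient j)) ⟩
      sum0belowℕ M (λ m → sum0belowℕ n (λ j → indicator (m <? quotient j)))
        ≡⟨ sum0belowℕ-cong M (λ {m} _ → sum0belowℕ-cong n (λ j<n → indicator-⇔ (m<quotient⇔⌊Q⌋≤j j<n) (m <? _) (⌊Q⌋ m ≤? _))) ⟩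
      sum0belowℕ M (λ m → sum0belowℕ n (λ j → indicator (⌊Q⌋ m ≤? j)))
        ≡⟨ sum0belowℕ-cong M (λ {m} _ → count-≥ n (⌊Q⌋ m)) ⟩
      sum0belowℕ M (λ m → n ∸ ⌊Q⌋ m)
        ∎
      where open ≡-Reasoning

    numerator-shift : ∀ j → suc j * suc j + 2 + p ≡ numerator j + (suc j + 3 * n)
    numerator-shift j = expand j e
      where
      expand : ∀ j e → suc j * suc j + 2 + (3 + 4 * e) ≡ j * suc j + suc e + 1 + (suc j + 3 * suc e)
      expand = solve-∀

    sum[n∸⌊Q⌋]+sum⌊Q⌋≡M*n : sum0belowℕ M (λ m → n ∸ ⌊Q⌋ m) + sum0belowℕ M ⌊Q⌋ ≡ M * n
    sum[n∸⌊Q⌋]+sum⌊Q⌋≡M*n = sum0belowℕ-∸ M n ⌊Q⌋ (<⇒≤ ∘ ⌊Q⌋<n)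

open import Data.Nat using (ℕ; _*_; _∸_; _<_)
open import Data.Nat.Primality using (Prime)
open import Data.Integer using (ℤ; +_; _+_; _-_)
open import Relation.Binary.PropositionalEquality using (_≡_)

import Data.Nat as ℕ
import Data.Nat.Properties as ℕ
import Data.Integer as ℤ
open import Data.Integer.DivMod using ([n/ℕd]*d≤n; n<s[n/ℕd]*d)
open import Data.Integer.Properties
  using (≤-antisym; ≤-<-trans; *-cancelʳ-<-nonNeg; i<j⇒i≤pred[j]; pred-suc; +-monoˡ-≤; +-monoˡ-<; pos-+; pos-*)
open import Data.Integer.Tactic.RingSolver using (solve-∀)
open import Function.Base using (_∘_)
open import Relation.Binary.PropositionalEquality using (refl; sym; trans; cong; cong₂; subst; module ≡-Reasoning)
open LatticePointCount using (module Setting)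
open FiniteSums using (sum0belowℕ)

/ℕ-unique : ∀ {a q} d .{{_ : ℕ.NonZero d}} → q ℤ.* + d ℤ.≤ a → a ℤ.< ℤ.suc q ℤ.* + d → a ℤ./ℕ d ≡ q
/ℕ-unique {a} {q} d qd≤a a<[1+q]d = ≤-antisym (cancel-bracket ([n/ℕd]*d≤n a d) a<[1+q]d) (cancel-bracket qd≤a (n<s[n/ℕd]*d a d))
  where
  cancel-bracket : ∀ {x y} → x ℤ.* + d ℤ.≤ a → a ℤ.< ℤ.suc y ℤ.* + d → x ℤ.≤ y
  cancel-bracket {x} {y} xd≤a a<[1+y]d =
    subst (x ℤ.≤_) (pred-suc y) (i<j⇒i≤pred[j] {j = ℤ.suc y} (*-cancelʳ-<-nonNeg (+ d) (≤-<-trans xd≤a a<[1+y]d)))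

[a-d]/ℕd≡a/ℕd-1 : ∀ a d .{{_ : ℕ.NonZero d}} → (a - + d) ℤ./ℕ d ≡ a ℤ./ℕ d - + 1
[a-d]/ℕd≡a/ℕd-1 a d = /ℕ-unique d
  (subst (ℤ._≤ a - + d) (sym (lower (a ℤ./ℕ d) (+ d))) (+-monoˡ-≤ (ℤ.- + d) ([n/ℕd]*d≤n a d)))
  (subst (a - + d ℤ.<_) (sym (upper (a ℤ./ℕ d) (+ d))) (+-monoˡ-< (ℤ.- + d) (n<s[n/ℕd]*d a d)))
  where
  lower : ∀ q d → (q - ℤ.1ℤ) ℤ.* d ≡ q ℤ.* d - d
  lower = solve-∀
  upper : ∀ q d → (ℤ.1ℤ + (q - ℤ.1ℤ)) ℤ.* d ≡ (ℤ.1ℤ + q) ℤ.* d - d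
  upper = solve-∀

+a-+b≡+c-+d : ∀ a b c d → a ℕ.+ d ≡ c ℕ.+ b → + a - + b ≡ + c - + d
+a-+b≡+c-+d a b c d a+d≡c+b = begin
  + a - + b                 ≡⟨ add-both (+ a) (+ b) (+ d) ⟩
  (+ a + + d) - (+ b + + d) ≡⟨ cong (_- (+ b + + d)) (trans (sym (pos-+ a d)) (trans (cong +_ a+d≡c+b) (pos-+ c b))) ⟩
  (+ c + + b) - (+ b + + d) ≡⟨ cancel (+ c) (+ b) (+ d) ⟩
  + c - + d                 ∎
  where
  open ≡-Reasoning
  add-both : ∀ x y z → x - y ≡ (x + z) - (y + z)
  add-both = solve-∀
  cancel : ∀ x y z → (x + y) - (y + z) ≡ x - z
  cancel = solve-∀

sum1to≡sum0below∘suc : ∀ n f → sum1to n f ≡ sum0below n (f ∘ ℕ.suc)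
sum1to≡sum0below∘suc ℕ.zero    f = refl
sum1to≡sum0below∘suc (ℕ.suc n) f = cong (_+ f (ℕ.suc n)) (sum1to≡sum0below∘suc n f)

sum0below-cong : ∀ M {f g : ℕ → ℤ} → (∀ m → f m ≡ g m) → sum0below M f ≡ sum0below M g
sum0below-cong ℕ.zero    f≗g = refl
sum0below-cong (ℕ.suc M) f≗g = cong₂ _+_ (sum0below-cong M f≗g) (f≗g M)

sum0below-pos : ∀ M f → sum0below M (+_ ∘ f) ≡ + sum0belowℕ M f
sum0below-pos ℕ.zero    f = refl
sum0below-pos (ℕ.suc M) f = trans (cong (_+ + f M) (sum0below-pos M f)) (sym (pos-+ (sum0belowℕ M f) (f M)))

sum0below[f-1] : ∀ M f → sum0below M (λ m → f m - + 1) ≡ sum0below M f - + M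
sum0below[f-1] ℕ.zero    f = refl
sum0below[f-1] (ℕ.suc M) f = begin
  sum0below M (λ m → f m - + 1) + (f M - + 1) ≡⟨ cong (_+ (f M - + 1)) (sum0below[f-1] M f) ⟩
  sum0below M f - + M + (f M - + 1)           ≡⟨ regroup (sum0below M f) (+ M) (f M) ⟩
  sum0below M f + f M - (ℤ.1ℤ + + M)          ≡⟨ cong (sum0below (ℕ.suc M) f -_) (sym (pos-+ 1 M)) ⟩
  sum0below (ℕ.suc M) f - + ℕ.suc M           ∎
  where
  open ≡-Reasoning
  regroup : ∀ s m x → s - m + (x - ℤ.1ℤ) ≡ s + x - (ℤ.1ℤ + m)
  regroup = solve-∀

+a-+n≡[+M-1]*+n-+s : ∀ {a s} M n → a ℕ.+ s ≡ M * n → + a - + n ≡ (+ M - + 1) ℤ.* + n - + s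
+a-+n≡[+M-1]*+n-+s {a} {s} M n a+s≡Mn = begin
  + a - + n                   ≡⟨ +a-+b≡+c-+d a n (M * n) (s ℕ.+ n) (trans (sym (ℕ.+-assoc a s n)) (cong (ℕ._+ n) a+s≡Mn)) ⟩
  + (M * n) - + (s ℕ.+ n)     ≡⟨ cong₂ _-_ (pos-* M n) (pos-+ s n) ⟩
  + M ℤ.* + n - (+ s + + n)   ≡⟨ regroup (+ M) (+ n) (+ s) ⟩
  (+ M - ℤ.1ℤ) ℤ.* + n - + s  ∎
  where
  open ≡-Reasoning
  regroup : ∀ m n s → m ℤ.* n - (s + n) ≡ (m - ℤ.1ℤ) ℤ.* n - s
  regroup = solve-∀

module _ (e : ℕ) (pr : Prime (3 ℕ.+ 4 * e)) where

  open Setting e pr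

  floorDiv-term : ∀ j → let k = ℕ.suc j in floorDiv (+ (k * k) - + k + + 2 - + (3 * n)) p ≡ + quotient j - + 1
  floorDiv-term j = trans (cong (ℤ._/ℕ p) (trans (regroup-casts k (k * k) (3 * n)) numerator-shifted)) ([a-d]/ℕd≡a/ℕd-1 (+ numerator j) p)
    where
    k = ℕ.suc j
    regroup : ∀ x y z w → x - y + z - w ≡ (x + z) - (y + w)
    regroup = solve-∀
    regroup-casts : ∀ k kk t → + kk - + k + + 2 - + t ≡ + (kk ℕ.+ 2) - + (k ℕ.+ t)
    regroup-casts k kk t = trans (regroup (+ kk) (+ k) (+ 2) (+ t)) (sym (cong₂ _-_ (pos-+ kk 2) (pos-+ k t)))
    numerator-shifted : + (k * k ℕ.+ 2) - + (k ℕ.+ 3 * n) ≡ + numerator j - + p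
    numerator-shifted = +a-+b≡+c-+d (k * k ℕ.+ 2) (k ℕ.+ 3 * n) (numerator j) p (numerator-shift j)

4[1+e]∸1≡3+4e : ∀ e → 4 * ℕ.suc e ∸ 1 ≡ 3 ℕ.+ 4 * e
4[1+e]∸1≡3+4e e = cong (_∸ 1) (ℕ.*-suc 4 e)

theorem5p6 : (n : ℕ) → 3 < n → Prime (4 * n ∸ 1) →
  sum1to n (λ k → floorDiv (+ (k * k) - + k + + 2 - + (3 * n)) (4 * n ∸ 1))
    ≡ (+ floorDivℕ (n * n) (4 * n ∸ 1) - + 1) Data.Integer.* + n
      - sum0below (floorDivℕ (n * n) (4 * n ∸ 1)) (λ m → + floorQ (4 * n ∸ 1) m)
theorem5p6 (ℕ.suc e) _ isPrime rewrite 4[1+e]∸1≡3+4e e = begin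
  sum1to n T                                   ≡⟨ sum1to≡sum0below∘suc n T ⟩
  sum0below n (T ∘ ℕ.suc)                      ≡⟨ sum0below-cong n (floorDiv-term e isPrime) ⟩
  sum0below n (λ j → + quotient j - + 1)       ≡⟨ sum0below[f-1] n (+_ ∘ quotient) ⟩
  sum0below n (+_ ∘ quotient) - + n            ≡⟨ cong (_- + n) (sum0below-pos n quotient) ⟩
  + sum0belowℕ n quotient - + n                ≡⟨ cong (λ s → + s - + n) sum-quotient≡sum[n∸⌊Q⌋] ⟩
  + sum0belowℕ M (λ m → n ∸ ⌊Q⌋ m) - + n       ≡⟨ +a-+n≡[+M-1]*+n-+s M n sum[n∸⌊Q⌋]+sum⌊Q⌋≡M*n ⟩
  (+ M - + 1) ℤ.* + n - + sum0belowℕ M ⌊Q⌋     ≡⟨ cong ((+ M - + 1) ℤ.* + n -_) (sum0below-pos M ⌊Q⌋) ⟨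
  (+ M - + 1) ℤ.* + n - sum0below M (+_ ∘ ⌊Q⌋) ∎
  where
  open Setting e isPrime
  open ≡-Reasoning
  T : ℕ → ℤ
  T k = floorDiv (+ (k * k) - + k + + 2 - + (3 * n)) p
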